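{- Let $G$ be a finite quasiprimitive permutation group of O'Nan–Scott type $\mathrm{HA}$, $\mathrm{HS}$, $\mathrm{HC}$ or $\mathrm{TW}$, and let $M$ be a point stabilizer. Then $M$ is a perfect code of $G$.
   Context: A permutation group is quasiprimitive if every non-trivial normal subgroup is transitive. Quasiprimitive groups fall into the eight types $\mathrm{HA},\mathrm{HS},\mathrm{HC},\mathrm{TW},\mathrm{SD},\mathrm{CD},\mathrm{AS},\mathrm{PA}$ of Praeger's O'Nan–Scott Theorem for quasiprimitive groups; in types $\mathrm{HA}$, $\mathrm{HS}$, $\mathrm{HC}$, $\mathrm{TW}$ the group has a minimal normal subgroup acting regularly. A perfect code in a simple undirected graph with vertex set $V$ is an independent subset $C\subseteq V$ such that every vertex in $V\setminus C$ is adjacent to exactly one vertex of $C$. For a group $G$ with identity $e$ and an inverse-closed $S\subseteq G\setminus\{e\}$, the Cayley graph $\mathrm{Cay}(G,S)$ has vertex set $G$ and edges $\{g,sg\}$ ($s\in S$, $g\in G$). A subset $C$ of $G$ is a perfect code of $G$ if it is a perfect code in some Cayley graph $\mathrm{Cay}(G,S)$. -}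

module Defs where

open import Level using (0ℓ)
open import Algebra.Bundles using (Group)
open import Data.Nat using (ℕ)
open import Data.Fin using (Fin)
open import Data.Product using (Σ; ∃; _×_; _,_)
open import Relation.Nullary using (¬_)
open import Relation.Binary.PropositionalEquality using (_≡_)
open import Data.Sum using () renaming (_⊎_ to _⊎'_)
open import Data.Unit using () renaming (⊤ to ⊤')

module _ (G : Group 0ℓ 0ℓ) where
  open Group G

  Subset : Set₁
  Subset = Carrier → Set

  IsFinite : Set
  IsFinite = Σ ℕ λ k → Σ (Fin k → Carrier) λ f → ∀ g → ∃ λ i → f i ≈ g

  record IsSubgroup (H : Subset) : Set where
    field
      resp  : ∀ {x y} → x ≈ y → H x → H y
      ε-mem : H ε
      ∙-mem : ∀ {x y} → H x → H y → H (x ∙ y)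
      ⁻¹-mem : ∀ {x} → H x → H (x ⁻¹)

  record IsNormalSubgroup (N : Subset) : Set where
    field
      isSubgroup : IsSubgroup N
      conj-mem   : ∀ g {x} → N x → N (g ∙ x ∙ g ⁻¹)

  Nontrivial : Subset → Set
  Nontrivial N = ∃ λ x → N x × ¬ (x ≈ ε)

  Trivial : Subset → Set
  Trivial N = ∀ x → N x → x ≈ ε

  record IsMinimalNormalSubgroup (N : Subset) : Set₁ where
    field
      isNormal   : IsNormalSubgroup N
      nontrivial : Nontrivial N
      minimal    : ∀ (K : Subset) → IsNormalSubgroup K → (∀ x → K x → N x) →
                   Trivial K ⊎' (∀ x → N x → K x)

  record Action (n : ℕ) : Set where
    field
      act      : Carrier → Fin n → Fin n
      act-cong : ∀ {g h} → g ≈ h → ∀ x → act g x ≡ act h x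
      act-ε    : ∀ x → act ε x ≡ x
      act-∙    : ∀ g h x → act (g ∙ h) x ≡ act g (act h x)

  module _ {n : ℕ} (A : Action n) where
    open Action A

    -- permutation group = faithful action
    Faithful : Set
    Faithful = ∀ g → (∀ x → act g x ≡ x) → g ≈ ε

    TransitiveOn : Subset → Set
    TransitiveOn K = ∀ x y → ∃ λ g → K g × act g x ≡ y

    RegularOn : Subset → Set
    RegularOn K = TransitiveOn K × (∀ g x → K g → act g x ≡ x → g ≈ ε)

    Quasiprimitive : Set₁
    Quasiprimitive = TransitiveOn (λ _ → ⊤') ×
      (∀ (N : Subset) → IsNormalSubgroup N → Nontrivial N → TransitiveOn N)

    Stab : Fin n → Subset
    Stab ω g = act g ω ≡ ω

  -- Cayley graph Cay(G,S): edges {g, s g}, s ∈ S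
  record IsConnectionSet (S : Subset) : Set where
    field
      resp     : ∀ {x y} → x ≈ y → S x → S y
      no-ε     : ¬ S ε
      inv-closed : ∀ {x} → S x → S (x ⁻¹)

  Adj : Subset → Carrier → Carrier → Set
  Adj S x y = ∃ λ s → S s × y ≈ s ∙ x

  record IsPerfectCodeIn (S : Subset) (C : Subset) : Set where
    field
      independent : ∀ x y → C x → C y → ¬ Adj S x y
      dominating  : ∀ v → ¬ C v → ∃ λ c → C c × Adj S v c
      unique      : ∀ v c c′ → ¬ C v → C c → Adj S v c → C c′ → Adj S v c′ → c ≈ c′

  IsPerfectCodeOfGroup : Subset → Set₁
  IsPerfectCodeOfGroup C = ∃ λ (S : Subset) → IsConnectionSet S × IsPerfectCodeIn S C

{-# OPTIONS --safe #-}
-- Let N be regular and M = Stab ω. Every right coset N v meets M in exactly one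
-- point, namely s v for the unique s ∈ N with s (v ω) = ω. With S = N ∖ {1} the
-- graph Cay(G, S) is the disjoint union of the complete graphs on the cosets N v,
-- so M picks exactly one vertex from each component: a perfect code.
module Submission where

open import Defs
open import Level using (0ℓ)
open import Algebra.Bundles using (Group)
open import Data.Nat using (ℕ)
open import Data.Fin using (Fin)
open import Data.Product using (∃; _×_; _,_)
open import Relation.Nullary using (¬_)
open import Relation.Binary.PropositionalEquality as ≡ using (_≡_)
import Algebra.Properties.Group as GroupProperties

module _ {G : Group 0ℓ 0ℓ} where
  open Group G
  open GroupProperties G

  NonIdentity : Subset G → Subset G
  NonIdentity N g = N g × ¬ (g ≈ ε)

  nonIdentity-isConnectionSet : ∀ {N} → IsSubgroup G N → IsConnectionSet G (NonIdentity N)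
  nonIdentity-isConnectionSet N-sub = record
    { resp       = λ x≈y (Nx , x≉ε) → resp x≈y Nx , λ y≈ε → x≉ε (trans x≈y y≈ε)
    ; no-ε       = λ (_ , ε≉ε) → ε≉ε refl
    ; inv-closed = λ (Nx , x≉ε) → ⁻¹-mem Nx , λ x⁻¹≈ε → x≉ε (⁻¹-injective (trans x⁻¹≈ε (sym ε⁻¹≈ε)))
    }
    where open IsSubgroup N-sub

  module _ {n : ℕ} (A : Action G n) where
    open Action A

    act-⁻¹ : ∀ g x → act (g ⁻¹) (act g x) ≡ x
    act-⁻¹ g x = begin
      act (g ⁻¹) (act g x) ≡⟨ act-∙ (g ⁻¹) g x ⟨
      act (g ⁻¹ ∙ g) x     ≡⟨ act-cong (inverseˡ g) x ⟩
      act ε x              ≡⟨ act-ε x ⟩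
      x                    ∎
      where open ≡.≡-Reasoning

    act-cong-∙ : ∀ {c s v} x → c ≈ s ∙ v → act c x ≡ act s (act v x)
    act-cong-∙ {s = s} {v} x c≈sv = ≡.trans (act-cong c≈sv x) (act-∙ s v x)

    semiregular-act-injective :
      ∀ {N} → IsSubgroup G N → (∀ g x → N g → act g x ≡ x → g ≈ ε) →
      ∀ {s s′} x → N s → N s′ → act s x ≡ act s′ x → s ≈ s′
    semiregular-act-injective N-sub semireg {s} {s′} x Ns Ns′ sx≡s′x =
      x∙y⁻¹≈ε⇒x≈y s s′ (semireg (s ∙ s′ ⁻¹) (act s′ x) (∙-mem Ns (⁻¹-mem Ns′)) fixes-s′x)
      where
        open IsSubgroup N-sub
        fixes-s′x : act (s ∙ s′ ⁻¹) (act s′ x) ≡ act s′ x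
        fixes-s′x = begin
          act (s ∙ s′ ⁻¹) (act s′ x)      ≡⟨ act-∙ s (s′ ⁻¹) (act s′ x) ⟩
          act s (act (s′ ⁻¹) (act s′ x))  ≡⟨ ≡.cong (act s) (act-⁻¹ s′ x) ⟩
          act s x                         ≡⟨ sx≡s′x ⟩
          act s′ x                        ∎
          where open ≡.≡-Reasoning

    regular-stabilizer-isPerfectCode :
      ∀ {N} → IsSubgroup G N → RegularOn G A N → ∀ ω →
      IsPerfectCodeIn G (NonIdentity N) (Stab G A ω)
    regular-stabilizer-isPerfectCode {N} N-sub (transitive , semiregular) ω = record
      { independent = independent
      ; dominating  = dominating
      ; unique      = unique
      }
      where
        M = Stab G A ω

        sends-to-ω : ∀ {v c s} → M c → c ≈ s ∙ v → act s (act v ω) ≡ ω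
        sends-to-ω cω c≈sv = ≡.trans (≡.sym (act-cong-∙ ω c≈sv)) cω

        independent : ∀ x y → M x → M y → ¬ Adj G (NonIdentity N) x y
        independent x y xω yω (s , (Ns , s≉ε) , y≈sx) =
          s≉ε (semiregular s ω Ns (≡.subst (λ z → act s z ≡ ω) xω (sends-to-ω yω y≈sx)))

        dominating : ∀ v → ¬ M v → ∃ λ c → M c × Adj G (NonIdentity N) v c
        dominating v v∉M with transitive (act v ω) ω
        ... | s , Ns , s-sends = s ∙ v , ≡.trans (act-∙ s v ω) s-sends , s , (Ns , s≉ε) , refl
          where
            s≉ε : ¬ s ≈ ε
            s≉ε s≈ε = v∉M (begin
              act v ω          ≡⟨ act-ε (act v ω) ⟨
              act ε (act v ω)  ≡⟨ act-cong s≈ε (act v ω) ⟨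
              act s (act v ω)  ≡⟨ s-sends ⟩
              ω                ∎)
              where open ≡.≡-Reasoning

        unique : ∀ v c c′ → ¬ M v → M c → Adj G (NonIdentity N) v c →
                 M c′ → Adj G (NonIdentity N) v c′ → c ≈ c′
        unique v c c′ _ cω (s , (Ns , _) , c≈sv) c′ω (s′ , (Ns′ , _) , c′≈s′v) =
          trans c≈sv (trans (∙-congʳ s≈s′) (sym c′≈s′v))
          where
            s≈s′ : s ≈ s′
            s≈s′ = semiregular-act-injective N-sub semiregular (act v ω) Ns Ns′
                     (≡.trans (sends-to-ω cω c≈sv) (≡.sym (sends-to-ω c′ω c′≈s′v)))

lemma5p2 : (G : Group 0ℓ 0ℓ) → IsFinite G → (n : ℕ) → (A : Action G n) →
    Faithful G A → Quasiprimitive G A →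
    (∃ λ (N : Subset G) → IsMinimalNormalSubgroup G N × RegularOn G A N) →
    (ω : Fin n) → IsPerfectCodeOfGroup G (Stab G A ω)
lemma5p2 G _ n A _ _ (N , N-minimal , N-regular) ω =
  NonIdentity {G = G} N , nonIdentity-isConnectionSet N-subgroup ,
  regular-stabilizer-isPerfectCode A N-subgroup N-regular ω
  where
    N-subgroup : IsSubgroup G N
    N-subgroup = IsNormalSubgroup.isSubgroup (IsMinimalNormalSubgroup.isNormal N-minimal)
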